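{- For every integer $n\ge 2$, \[ \left[\frac{n+2\left[\frac{n-3}{7}\right]}{3}\right]\le S_d(n)\le \left[\frac{n}{2}\right], \] where $[x]$ denotes the integer part (floor) of $x$.
   Context: A word is a finite word over the two-letter alphabet $\{a,b\}$; $l(w)$ denotes the length of $w$, and powers/concatenation are written multiplicatively (e.g. $b^{3}(ab)^2$). A word $w=a_1\cdots a_n$ is a palindrome if $a_i=a_{n-i+1}$ for all $i\le n$, and an antipalindrome if $a_i\ne a_{n-i+1}$ for all $i\le n$. Deleting letters from $w$ means passing to a subsequence of $w$ (the remaining letters keep their order). For a word $w$, $S_d(w)$ is the minimal number of letters of $w$ whose deletion from $w$ yields a palindrome or an antipalindrome. For a positive integer $n$, $S_d(n)=\max\{S_d(w): w \text{ a word with } l(w)=n\}$. -}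

module Defs where

open import Data.Nat using (ℕ; _+_; _≤_)
open import Data.List using (List; length; lookup)
open import Data.List.Relation.Binary.Sublist.Propositional using (_⊆_)
open import Data.Fin using (Fin; opposite)
open import Data.Product using (Σ; _×_; ∃)
open import Data.Sum using (_⊎_)
open import Relation.Binary.PropositionalEquality using (_≡_; _≢_)

data Letter : Set where
  a b : Letter

Word : Set
Word = List Letter

-- w = a_1 ... a_n is a palindrome iff a_i = a_{n-i+1} for all i
-- (0-indexed: position i versus position n-1-i = opposite i).
Palindrome : Word → Set
Palindrome w = (i : Fin (length w)) → lookup w i ≡ lookup w (opposite i)

Antipalindrome : Word → Set
Antipalindrome w = (i : Fin (length w)) → lookup w i ≢ lookup w (opposite i)

DeletableTo : Word → ℕ → Set
DeletableTo w k =
  Σ Word (λ v → (v ⊆ w) × (length v + k ≡ length w) × (Palindrome v ⊎ Antipalindrome v))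

IsSdWord : Word → ℕ → Set
IsSdWord w k = DeletableTo w k × ((j : ℕ) → DeletableTo w j → k ≤ j)

IsSd : ℕ → ℕ → Set
IsSd n m =
  Σ Word (λ w → (length w ≡ n) × IsSdWord w m)
  × ((w : Word) → length w ≡ n → (k : ℕ) → IsSdWord w k → k ≤ m)

-- Upper bound: one of the two letters occurs at most l(w)/2 times in w, and deleting all its
-- occurrences leaves a constant word, which is a palindrome.
--
-- Lower bound: write n = 3 + r + 7t with r < 7 and take w = (aab)^t a^x b^y, x = 2t + p, y = 2t + q.
-- A palindromic subsequence using k letters of b^y begins with b^k as well; peeling these off
-- leaves a palindrome u a^j inside (aab)^t' a^x with k + t' ≤ t, which either consists of a's or
-- begins with a^j, and then (aab)^t' has too few a's left: either way the palindrome has length at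
-- most 2t + x.  An antipalindrome has as many a's as b's; if it uses a b of (aab)^t, it begins with
-- a^k, k its number of b's from b^y, and these a's use up about k/2 blocks aab, so its length is at
-- most 2y or 2t + 2 + y.  So at most 4t + B letters survive, and the constants p, q, B are chosen
-- such that n − 4t − B ≥ ⌊(n + 2t)/3⌋.

module Submission where

open import Defs
open import Data.Nat using (ℕ; zero; suc; _+_; _*_; _∸_; _≤_; _<_; z≤n; s≤s; s≤s⁻¹)
open import Data.Nat.Properties hiding (_≟_)
open import Data.Nat.Properties using () renaming (_≟_ to _≟ℕ_)
open import Data.Nat.Tactic.RingSolver using (solve; solve-∀)
open import Data.Nat.DivMod using (_/_; _%_; /-monoˡ-≤; m*n/n≡m; +-distrib-/-∣ˡ; m<n*o⇒m/o<n; m%n<n; m≡m%n+[m/n]*n)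
open import Data.Nat.Divisibility using (divides)
open import Data.List using (List; []; _∷_; [_]; _++_; filter; length; lookup; map; replicate; reverse; tabulate)
open import Data.List.Properties
  using (++-assoc; ++-cancelˡ; ++-cancelʳ; length-++; length-replicate; map-++; map-replicate; map-tabulate;
         reverse-++; tabulate-cong; tabulate-lookup; unfold-reverse; ∷-injective; ∷-injectiveʳ)
open import Data.List.Relation.Binary.Sublist.Propositional using ([]; _∷_; _∷ʳ_; _⊆_; minimum; ⊆-refl; ⊆-trans)
open import Data.List.Relation.Binary.Sublist.Propositional.Properties using (All-resp-⊆; length-mono-≤)
open import Data.List.Relation.Unary.All as All using (All; []; _∷_; all?)
open import Data.List.Relation.Unary.All.Properties using (replicate⁺; ¬All⇒Any¬)
open import Data.List.Relation.Unary.Any using (Any; here; there)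
open import Data.List.Membership.Propositional using (_∈_)
open import Data.List.Membership.Propositional.Properties
  using (∈-lookup; ∈-filter⁺; ∈-filter⁻; ∈-map⁺; ∈-map⁻; ∈-++⁺ˡ; ∈-++⁺ʳ; ∈-++⁻)
open import Data.List.Extrema.Nat using (argmax; argmax-all; f[xs]≤f[argmax])
open import Data.Fin using (Fin; zero; suc; fromℕ; inject₁; opposite)
import Data.Fin.Properties as Fin
open import Data.Product using (Σ; ∃; ∃₂; _×_; _,_; proj₁; proj₂)
open import Data.Sum using (_⊎_; inj₁; inj₂)
open import Function using (_∘_)
open import Relation.Binary.Definitions using (DecidableEquality)
open import Relation.Binary.PropositionalEquality
  using (_≡_; _≢_; refl; sym; trans; cong; cong₂; subst; subst₂; module ≡-Reasoning)
open import Relation.Nullary using (yes; no; ¬?; contradiction)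
open import Relation.Nullary.Decidable using (Dec; True; toWitness; _×-dec_; _⊎-dec_)
open import Relation.Unary using (Decidable)

private
  variable
    A : Set
    c : Letter
    u v w : Word
    n : ℕ

tabulate-∷ʳ : ∀ {n} (f : Fin (suc n) → A) → tabulate f ≡ tabulate (f ∘ inject₁) ++ f (fromℕ n) ∷ []
tabulate-∷ʳ {n = zero} f = refl
tabulate-∷ʳ {n = suc n} f = cong (f zero ∷_) (tabulate-∷ʳ (f ∘ suc))

reverse-tabulate : ∀ {n} (f : Fin n → A) → reverse (tabulate f) ≡ tabulate (f ∘ opposite)
reverse-tabulate {n = zero} f = refl
reverse-tabulate {n = suc n} f = begin
  reverse (f zero ∷ tabulate (f ∘ suc))
    ≡⟨ unfold-reverse (f zero) (tabulate (f ∘ suc)) ⟩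
  reverse (tabulate (f ∘ suc)) ++ f zero ∷ []
    ≡⟨ cong (_++ f zero ∷ []) (reverse-tabulate (f ∘ suc)) ⟩
  tabulate (f ∘ suc ∘ opposite) ++ f zero ∷ []
    ≡⟨ cong₂ (λ xs x → xs ++ x ∷ []) (tabulate-cong (cong f ∘ opposite-inject₁)) (cong f (opposite-fromℕ n)) ⟨
  tabulate (f ∘ opposite ∘ inject₁) ++ f (opposite (fromℕ n)) ∷ []
    ≡⟨ tabulate-∷ʳ (f ∘ opposite) ⟨
  tabulate (f ∘ opposite)
    ∎
  where
  open ≡-Reasoning
  opposite-fromℕ : ∀ n → opposite (fromℕ n) ≡ zero
  opposite-fromℕ zero = refl
  opposite-fromℕ (suc n) = cong inject₁ (opposite-fromℕ n)
  opposite-inject₁ : ∀ {n} (i : Fin n) → opposite (inject₁ i) ≡ suc (opposite i)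
  opposite-inject₁ {suc n} zero = refl
  opposite-inject₁ {suc n} (suc i) = cong inject₁ (opposite-inject₁ i)

All≡⇒replicate : ∀ {x : A} {xs} → All (_≡ x) xs → xs ≡ replicate (length xs) x
All≡⇒replicate [] = refl
All≡⇒replicate (refl ∷ all) = cong (_ ∷_) (All≡⇒replicate all)

⊆-++⁻ : ∀ (xs : List A) {ys v} → v ⊆ xs ++ ys → ∃₂ λ v₁ v₂ → v ≡ v₁ ++ v₂ × v₁ ⊆ xs × v₂ ⊆ ys
⊆-++⁻ [] p = [] , _ , refl , [] , p
⊆-++⁻ (x ∷ xs) (.x ∷ʳ p) with v₁ , v₂ , refl , p₁ , p₂ ← ⊆-++⁻ xs p =
  v₁ , v₂ , refl , x ∷ʳ p₁ , p₂
⊆-++⁻ (x ∷ xs) (refl ∷ p) with v₁ , v₂ , refl , p₁ , p₂ ← ⊆-++⁻ xs p =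
  x ∷ v₁ , v₂ , refl , refl ∷ p₁ , p₂

++-⊆⁻ : ∀ (u : List A) {w z} → u ++ w ⊆ z → ∃₂ λ z₁ z₂ → z ≡ z₁ ++ z₂ × u ⊆ z₁ × w ⊆ z₂
++-⊆⁻ [] p = [] , _ , refl , [] , p
++-⊆⁻ (x ∷ u) (y ∷ʳ p) with z₁ , z₂ , refl , p₁ , p₂ ← ++-⊆⁻ (x ∷ u) p =
  y ∷ z₁ , z₂ , refl , y ∷ʳ p₁ , p₂
++-⊆⁻ (x ∷ u) (refl ∷ p) with z₁ , z₂ , refl , p₁ , p₂ ← ++-⊆⁻ u p =
  x ∷ z₁ , z₂ , refl , refl ∷ p₁ , p₂

replicate-prefix : ∀ {x : A} {xs ys zs} k → Any (_≢ x) xs → xs ++ ys ≡ replicate k x ++ zs →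
                   ∃ λ xs′ → xs ≡ replicate k x ++ xs′
replicate-prefix zero _ _ = _ , refl
replicate-prefix (suc k) (here x′≢x) e = contradiction (proj₁ (∷-injective e)) x′≢x
replicate-prefix (suc k) (there any) e with refl , e′ ← ∷-injective e
  with xs′ , refl ← replicate-prefix k any e′ = xs′ , refl

replicate-++-injective : ∀ {x y : A} {s s′} m k → y ≢ x →
                         replicate m x ++ y ∷ s ≡ replicate k x ++ y ∷ s′ → m ≡ k
replicate-++-injective zero zero _ _ = refl
replicate-++-injective zero (suc k) y≢x e = contradiction (proj₁ (∷-injective e)) y≢x
replicate-++-injective (suc m) zero y≢x e = contradiction (sym (proj₁ (∷-injective e))) y≢x
replicate-++-injective (suc m) (suc k) y≢x e = cong suc (replicate-++-injective m k y≢x (∷-injectiveʳ e))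

++-cancel-ends : ∀ (s : List A) {xs ys} → s ++ xs ++ s ≡ s ++ ys ++ s → xs ≡ ys
++-cancel-ends s {xs} {ys} e = ++-cancelʳ s xs ys (++-cancelˡ s (xs ++ s) (ys ++ s) e)

subsequences : List A → List (List A)
subsequences [] = [] ∷ []
subsequences (x ∷ xs) = map (x ∷_) (subsequences xs) ++ subsequences xs

∈-subsequences⁺ : ∀ {xs ys : List A} → xs ⊆ ys → xs ∈ subsequences ys
∈-subsequences⁺ [] = here refl
∈-subsequences⁺ (_∷ʳ_ {ys = ys} y p) = ∈-++⁺ʳ (map (y ∷_) (subsequences ys)) (∈-subsequences⁺ p)
∈-subsequences⁺ (refl ∷ p) = ∈-++⁺ˡ (∈-map⁺ _ (∈-subsequences⁺ p))

∈-subsequences⁻ : ∀ (ys : List A) {xs} → xs ∈ subsequences ys → xs ⊆ ys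
∈-subsequences⁻ [] (here refl) = []
∈-subsequences⁻ (y ∷ ys) m with ∈-++⁻ (map (y ∷_) (subsequences ys)) m
... | inj₁ m′ with xs , m″ , refl ← ∈-map⁻ (y ∷_) m′ = refl ∷ ∈-subsequences⁻ ys m″
... | inj₂ m′ = y ∷ʳ ∈-subsequences⁻ ys m′

m+m≤n⇒m≤n/2 : ∀ {m n} → m + m ≤ n → m ≤ n / 2
m+m≤n⇒m≤n/2 {m} {n} m+m≤n = begin
  m         ≡⟨ m*n/n≡m m 2 ⟨
  m * 2 / 2 ≤⟨ /-monoˡ-≤ 2 (≤-trans (≤-reflexive (m*2≡m+m m)) m+m≤n) ⟩
  n / 2     ∎
  where
  open ≤-Reasoning
  m*2≡m+m : ∀ m → m * 2 ≡ m + m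
  m*2≡m+m = solve-∀

m+m≤n⇒m+m≤2*[n/2] : ∀ {m n} → m + m ≤ n → m + m ≤ 2 * (n / 2)
m+m≤n⇒m+m≤2*[n/2] {m} {n} m+m≤n = begin
  m + m       ≡⟨ solve [ m ] ⟩
  2 * m       ≤⟨ *-monoʳ-≤ 2 (m+m≤n⇒m≤n/2 {m} m+m≤n) ⟩
  2 * (n / 2) ∎
  where open ≤-Reasoning

[2m+n]/2≡m+n/2 : ∀ m n → (2 * m + n) / 2 ≡ m + n / 2
[2m+n]/2≡m+n/2 m n = begin
  (2 * m + n) / 2     ≡⟨ +-distrib-/-∣ˡ {2 * m} n (divides m (*-comm 2 m)) ⟩
  2 * m / 2 + n / 2   ≡⟨ cong (_+ n / 2) (trans (cong (_/ 2) (*-comm 2 m)) (m*n/n≡m m 2)) ⟩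
  m + n / 2           ∎
  where open ≡-Reasoning

other : Letter → Letter
other a = b
other b = a

_≟_ : DecidableEquality Letter
a ≟ a = yes refl
a ≟ b = no λ ()
b ≟ a = no λ ()
b ≟ b = yes refl

≢⇒≡other : ∀ {x y} → x ≢ y → x ≡ other y
≢⇒≡other {a} {a} x≢y with () ← x≢y refl
≢⇒≡other {a} {b} _ = refl
≢⇒≡other {b} {a} _ = refl
≢⇒≡other {b} {b} x≢y with () ← x≢y refl

All≡-or-Any≢ : ∀ c w → All (_≡ c) w ⊎ Any (_≢ c) w
All≡-or-Any≢ c w with all? (_≟ c) w
... | yes all = inj₁ all
... | no ¬all = inj₂ (¬All⇒Any¬ (_≟ c) w ¬all)

infix 8 _^_

_^_ : Letter → ℕ → Word
c ^ n = replicate n c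

occ : Letter → Word → ℕ
occ c [] = 0
occ a (a ∷ w) = suc (occ a w)
occ a (b ∷ w) = occ a w
occ b (a ∷ w) = occ b w
occ b (b ∷ w) = suc (occ b w)

occ-++ : ∀ c u v → occ c (u ++ v) ≡ occ c u + occ c v
occ-++ c [] v = refl
occ-++ a (a ∷ u) v = cong suc (occ-++ a u v)
occ-++ a (b ∷ u) v = occ-++ a u v
occ-++ b (a ∷ u) v = occ-++ b u v
occ-++ b (b ∷ u) v = cong suc (occ-++ b u v)

occ-mono : ∀ c → u ⊆ v → occ c u ≤ occ c v
occ-mono c [] = z≤n
occ-mono a (a ∷ʳ p) = m≤n⇒m≤1+n (occ-mono a p)
occ-mono a (b ∷ʳ p) = occ-mono a p
occ-mono b (a ∷ʳ p) = occ-mono b p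
occ-mono b (b ∷ʳ p) = m≤n⇒m≤1+n (occ-mono b p)
occ-mono a (_∷_ {a} refl p) = s≤s (occ-mono a p)
occ-mono a (_∷_ {b} refl p) = occ-mono a p
occ-mono b (_∷_ {a} refl p) = occ-mono b p
occ-mono b (_∷_ {b} refl p) = s≤s (occ-mono b p)

occ+occ-other : ∀ c w → occ c w + occ (other c) w ≡ length w
occ+occ-other c [] = refl
occ+occ-other a (a ∷ w) = cong suc (occ+occ-other a w)
occ+occ-other a (b ∷ w) = trans (+-suc _ _) (cong suc (occ+occ-other a w))
occ+occ-other b (a ∷ w) = trans (+-suc _ _) (cong suc (occ+occ-other b w))
occ+occ-other b (b ∷ w) = cong suc (occ+occ-other b w)

occ-replicate : ∀ c n → occ c (c ^ n) ≡ n
occ-replicate c zero = refl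
occ-replicate a (suc n) = cong suc (occ-replicate a n)
occ-replicate b (suc n) = cong suc (occ-replicate b n)

occ-other-replicate : ∀ c n → occ (other c) (c ^ n) ≡ 0
occ-other-replicate c zero = refl
occ-other-replicate a (suc n) = occ-other-replicate a n
occ-other-replicate b (suc n) = occ-other-replicate b n

occ-reverse : ∀ c w → occ c (reverse w) ≡ occ c w
occ-reverse c [] = refl
occ-reverse c (x ∷ w) = begin
  occ c (reverse (x ∷ w))            ≡⟨ cong (occ c) (unfold-reverse x w) ⟩
  occ c (reverse w ++ x ∷ [])        ≡⟨ occ-++ c (reverse w) (x ∷ []) ⟩
  occ c (reverse w) + occ c (x ∷ []) ≡⟨ cong (_+ occ c (x ∷ [])) (occ-reverse c w) ⟩
  occ c w + occ c (x ∷ [])           ≡⟨ +-comm (occ c w) _ ⟩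
  occ c (x ∷ []) + occ c w           ≡⟨ occ-++ c (x ∷ []) w ⟨
  occ c (x ∷ w)                      ∎
  where open ≡-Reasoning

occ-map-other : ∀ c w → occ c (map other w) ≡ occ (other c) w
occ-map-other c [] = refl
occ-map-other a (a ∷ w) = occ-map-other a w
occ-map-other a (b ∷ w) = cong suc (occ-map-other a w)
occ-map-other b (a ∷ w) = cong suc (occ-map-other b w)
occ-map-other b (b ∷ w) = occ-map-other b w

replicate-occ-⊆ : ∀ c w → c ^ occ c w ⊆ w
replicate-occ-⊆ c [] = []
replicate-occ-⊆ a (a ∷ w) = refl ∷ replicate-occ-⊆ a w
replicate-occ-⊆ a (b ∷ w) = b ∷ʳ replicate-occ-⊆ a w
replicate-occ-⊆ b (a ∷ w) = a ∷ʳ replicate-occ-⊆ b w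
replicate-occ-⊆ b (b ∷ w) = refl ∷ replicate-occ-⊆ b w

All≡⇒occ≡length : All (_≡ c) w → occ c w ≡ length w
All≡⇒occ≡length {c} {w} all = trans (cong (occ c) (All≡⇒replicate all)) (occ-replicate c (length w))

All≡⇒occ-other≡0 : All (_≡ c) w → occ (other c) w ≡ 0
All≡⇒occ-other≡0 {c} {w} all = trans (cong (occ (other c)) (All≡⇒replicate all)) (occ-other-replicate c (length w))

⊆-replicate⁻ : v ⊆ c ^ n → v ≡ c ^ length v × length v ≤ n
⊆-replicate⁻ {n = n} p =
  All≡⇒replicate (All-resp-⊆ p (replicate⁺ n refl)) ,
  subst (_ ≤_) (length-replicate n) (length-mono-≤ p)

-- Palindromes and antipalindromes as equations between words

Palindrome⇒≡reverse : Palindrome w → w ≡ reverse w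
Palindrome⇒≡reverse {w} pal = begin
  w                              ≡⟨ tabulate-lookup w ⟨
  tabulate (lookup w)            ≡⟨ tabulate-cong pal ⟩
  tabulate (lookup w ∘ opposite) ≡⟨ reverse-tabulate (lookup w) ⟨
  reverse (tabulate (lookup w))  ≡⟨ cong reverse (tabulate-lookup w) ⟩
  reverse w                      ∎
  where open ≡-Reasoning

Antipalindrome⇒≡map-other-reverse : Antipalindrome w → w ≡ map other (reverse w)
Antipalindrome⇒≡map-other-reverse {w} antipal = begin
  w                                          ≡⟨ tabulate-lookup w ⟨
  tabulate (lookup w)                        ≡⟨ tabulate-cong (≢⇒≡other ∘ antipal) ⟩
  tabulate (other ∘ lookup w ∘ opposite)     ≡⟨ map-tabulate (lookup w ∘ opposite) other ⟨
  map other (tabulate (lookup w ∘ opposite)) ≡⟨ cong (map other) (reverse-tabulate (lookup w)) ⟨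
  map other (reverse (tabulate (lookup w)))  ≡⟨ cong (map other ∘ reverse) (tabulate-lookup w) ⟩
  map other (reverse w)                      ∎
  where open ≡-Reasoning

All≡⇒Palindrome : All (_≡ c) w → Palindrome w
All≡⇒Palindrome all i = trans (All.lookup all (∈-lookup i)) (sym (All.lookup all (∈-lookup (opposite i))))

reverse-replicate : ∀ c n → reverse (c ^ n) ≡ c ^ n
reverse-replicate c n = sym (Palindrome⇒≡reverse (All≡⇒Palindrome (replicate⁺ n refl)))

antipalindrome⇒occ-a≡occ-b : v ≡ map other (reverse v) → occ a v ≡ occ b v
antipalindrome⇒occ-a≡occ-b {v} anti = begin
  occ a v                       ≡⟨ cong (occ a) anti ⟩
  occ a (map other (reverse v)) ≡⟨ occ-map-other a (reverse v) ⟩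
  occ b (reverse v)             ≡⟨ occ-reverse b v ⟩
  occ b v                       ∎
  where open ≡-Reasoning

PalOrAntipal : Word → Set
PalOrAntipal w = Palindrome w ⊎ Antipalindrome w

palOrAntipal? : Decidable PalOrAntipal
palOrAntipal? w = Fin.all? (λ i → lookup w i ≟ lookup w (opposite i))
             ⊎-dec Fin.all? (λ i → ¬? (lookup w i ≟ lookup w (opposite i)))

longestPalOrAntipal : Word → Word
longestPalOrAntipal w = argmax length [] (filter palOrAntipal? (subsequences w))

longestPalOrAntipal-spec : ∀ w → longestPalOrAntipal w ⊆ w × PalOrAntipal (longestPalOrAntipal w)
longestPalOrAntipal-spec w = argmax-all length (minimum w , inj₁ λ ()) (All.tabulate spec)
  where
  spec : ∀ {v} → v ∈ filter palOrAntipal? (subsequences w) → v ⊆ w × PalOrAntipal v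
  spec m with m′ , s ← ∈-filter⁻ palOrAntipal? m = ∈-subsequences⁻ w m′ , s

length≤longestPalOrAntipal : v ⊆ w → PalOrAntipal v → length v ≤ length (longestPalOrAntipal w)
length≤longestPalOrAntipal {w = w} p s =
  All.lookup (f[xs]≤f[argmax] [] (filter palOrAntipal? (subsequences w)))
             (∈-filter⁺ palOrAntipal? (∈-subsequences⁺ p) s)

sdWord : Word → ℕ
sdWord w = length w ∸ length (longestPalOrAntipal w)

IsSdWord-sdWord : ∀ w → IsSdWord w (sdWord w)
IsSdWord-sdWord w = deletable , minimal
  where
  L⊆w = proj₁ (longestPalOrAntipal-spec w)
  deletable : DeletableTo w (sdWord w)
  deletable = longestPalOrAntipal w , L⊆w , m+[n∸m]≡n (length-mono-≤ L⊆w) , proj₂ (longestPalOrAntipal-spec w)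
  minimal : ∀ j → DeletableTo w j → sdWord w ≤ j
  minimal j (v , v⊆w , v+j≡w , s) = begin
    length w ∸ length (longestPalOrAntipal w) ≤⟨ ∸-monoʳ-≤ (length w) (length≤longestPalOrAntipal v⊆w s) ⟩
    length w ∸ length v                       ≡⟨ cong (_∸ length v) v+j≡w ⟨
    length v + j ∸ length v                   ≡⟨ m+n∸m≡n (length v) j ⟩
    j                                         ∎
    where open ≤-Reasoning

IsSdWord-unique : ∀ {j k} → IsSdWord w j → IsSdWord w k → j ≡ k
IsSdWord-unique (dj , minj) (dk , mink) = ≤-antisym (minj _ dk) (mink _ dj)

words : ℕ → List Word
words zero = [] ∷ []
words (suc n) = map (a ∷_) (words n) ++ map (b ∷_) (words n)

∈-words⁺ : ∀ w → w ∈ words (length w)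
∈-words⁺ [] = here refl
∈-words⁺ (a ∷ w) = ∈-++⁺ˡ (∈-map⁺ _ (∈-words⁺ w))
∈-words⁺ (b ∷ w) = ∈-++⁺ʳ (map (a ∷_) (words (length w))) (∈-map⁺ _ (∈-words⁺ w))

∈-words⁻ : ∀ n → w ∈ words n → length w ≡ n
∈-words⁻ zero (here refl) = refl
∈-words⁻ (suc n) m with ∈-++⁻ (map (a ∷_) (words n)) m
... | inj₁ m′ with _ , m″ , refl ← ∈-map⁻ (a ∷_) m′ = cong suc (∈-words⁻ n m″)
... | inj₂ m′ with _ , m″ , refl ← ∈-map⁻ (b ∷_) m′ = cong suc (∈-words⁻ n m″)

IsSd-exists : ∀ n → Σ ℕ (IsSd n)
IsSd-exists n = sdWord w* , (w* , length-w* , IsSdWord-sdWord w*) , maximal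
  where
  w* = argmax sdWord (a ^ n) (words n)
  length-w* : length w* ≡ n
  length-w* = argmax-all sdWord (length-replicate n) (All.tabulate (∈-words⁻ n))
  maximal : ∀ w → length w ≡ n → ∀ k → IsSdWord w k → k ≤ sdWord w*
  maximal w refl k sd = subst (_≤ sdWord w*) (IsSdWord-unique (IsSdWord-sdWord w) sd)
    (All.lookup (f[xs]≤f[argmax] {f = sdWord} (a ^ n) (words n)) (∈-words⁺ w))

DeletableTo-occ-other : ∀ c w → DeletableTo w (occ (other c) w)
DeletableTo-occ-other c w =
  c ^ occ c w , replicate-occ-⊆ c w ,
  trans (cong (_+ occ (other c) w) (length-replicate (occ c w))) (occ+occ-other c w) ,
  inj₁ (All≡⇒Palindrome (replicate⁺ (occ c w) refl))

IsSdWord⇒≤half : ∀ {k} → IsSdWord w k → k ≤ length w / 2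
IsSdWord⇒≤half {w} {k} (_ , minimal) = m+m≤n⇒m≤n/2 (begin
  k + k             ≤⟨ +-mono-≤ (minimal _ (DeletableTo-occ-other b w)) (minimal _ (DeletableTo-occ-other a w)) ⟩
  occ a w + occ b w ≡⟨ occ+occ-other a w ⟩
  length w          ∎)
  where open ≤-Reasoning

-- Suffixes of (aab)^t

aab^_ : ℕ → Word
aab^ zero = []
aab^ suc t = a ∷ a ∷ b ∷ aab^ t

length-aab^ : ∀ t → length (aab^ t) ≡ 3 * t
length-aab^ zero = refl
length-aab^ (suc t) = trans (cong (3 +_) (length-aab^ t)) (sym (*-distribˡ-+ 3 1 t))

occ-a-aab^ : ∀ t → occ a (aab^ t) ≡ 2 * t
occ-a-aab^ zero = refl
occ-a-aab^ (suc t) = trans (cong (2 +_) (occ-a-aab^ t)) (sym (*-distribˡ-+ 2 1 t))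

occ-b-aab^ : ∀ t → occ b (aab^ t) ≡ t
occ-b-aab^ zero = refl
occ-b-aab^ (suc t) = cong suc (occ-b-aab^ t)

data AabTail : Word → Set where
  aab^-tail : ∀ t → AabTail (aab^ t)
  ab-tail : ∀ t → AabTail (a ∷ b ∷ aab^ t)
  b-tail : ∀ t → AabTail (b ∷ aab^ t)

AabTail-suffix : ∀ t z₁ {z₂} → aab^ t ≡ z₁ ++ z₂ → AabTail z₂
AabTail-suffix t [] refl = aab^-tail t
AabTail-suffix (suc t) (_ ∷ []) refl = ab-tail t
AabTail-suffix (suc t) (_ ∷ _ ∷ []) refl = b-tail t
AabTail-suffix (suc t) (_ ∷ _ ∷ _ ∷ z₁) e = AabTail-suffix t z₁ (∷-injectiveʳ (∷-injectiveʳ (∷-injectiveʳ e)))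

AabTail-occ-b≤ : AabTail w → occ b w ≤ suc (occ a w)
AabTail-occ-b≤ (aab^-tail t) rewrite occ-a-aab^ t | occ-b-aab^ t = m≤n⇒m≤1+n (m≤m+n t (t + 0))
AabTail-occ-b≤ (ab-tail t) rewrite occ-a-aab^ t | occ-b-aab^ t = s≤s (m≤n⇒m≤1+n (m≤m+n t (t + 0)))
AabTail-occ-b≤ (b-tail t) rewrite occ-a-aab^ t | occ-b-aab^ t = s≤s (m≤m+n t (t + 0))

AabTail-2*occ-b≤ : AabTail w → 2 * occ b w ≤ occ a w + 2
AabTail-2*occ-b≤ (aab^-tail t) rewrite occ-a-aab^ t | occ-b-aab^ t = m≤m+n (2 * t) 2
AabTail-2*occ-b≤ (ab-tail t) rewrite occ-a-aab^ t | occ-b-aab^ t = begin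
  2 * suc t       ≡⟨ solve [ t ] ⟩
  2 * t + 2       ≤⟨ n≤1+n _ ⟩
  suc (2 * t) + 2 ∎
  where open ≤-Reasoning
AabTail-2*occ-b≤ (b-tail t) rewrite occ-a-aab^ t | occ-b-aab^ t = begin
  2 * suc t ≡⟨ solve [ t ] ⟩
  2 * t + 2 ∎
  where open ≤-Reasoning

AabTail-⊆ : AabTail w → w ⊆ aab^ (occ b w)
AabTail-⊆ (aab^-tail t) rewrite occ-b-aab^ t = ⊆-refl
AabTail-⊆ (ab-tail t) rewrite occ-b-aab^ t = a ∷ʳ ⊆-refl
AabTail-⊆ (b-tail t) rewrite occ-b-aab^ t = a ∷ʳ a ∷ʳ ⊆-refl

aab^-split : ∀ t u {w} → u ++ w ⊆ aab^ t →
             ∃ λ z → AabTail z × w ⊆ z × (∀ c → occ c u + occ c z ≤ occ c (aab^ t))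
aab^-split t u p with z₁ , z₂ , e , u⊆z₁ , w⊆z₂ ← ++-⊆⁻ u p =
  z₂ , AabTail-suffix t z₁ e , w⊆z₂ , bound
  where
  bound : ∀ c → occ c u + occ c z₂ ≤ occ c (aab^ t)
  bound c = begin
    occ c u + occ c z₂  ≤⟨ +-monoˡ-≤ (occ c z₂) (occ-mono c u⊆z₁) ⟩
    occ c z₁ + occ c z₂ ≡⟨ occ-++ c z₁ z₂ ⟨
    occ c (z₁ ++ z₂)    ≡⟨ cong (occ c) e ⟨
    occ c (aab^ t)      ∎
    where open ≤-Reasoning

b^++⊆aab^ : ∀ t k {w} → b ^ k ++ w ⊆ aab^ t → ∃ λ t′ → k + t′ ≤ t × w ⊆ aab^ t′
b^++⊆aab^ t k p with z , tail , w⊆z , bound ← aab^-split t (b ^ k) p =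
  occ b z ,
  subst₂ _≤_ (cong (_+ occ b z) (occ-replicate b k)) (occ-b-aab^ t) (bound b) ,
  ⊆-trans w⊆z (AabTail-⊆ tail)

a^++⊆aab^-length : ∀ t e {w} → a ^ e ++ w ⊆ aab^ t → 2 * e + length w ≤ 4 * t + 1
a^++⊆aab^-length t e {w} p with z , tail , w⊆z , bound ← aab^-split t (a ^ e) p = begin
  2 * e + length w                  ≤⟨ +-monoʳ-≤ (2 * e) (length-mono-≤ w⊆z) ⟩
  2 * e + length z                  ≡⟨ cong (2 * e +_) (occ+occ-other a z) ⟨
  2 * e + (occ a z + occ b z)       ≤⟨ +-monoʳ-≤ (2 * e) (+-monoʳ-≤ (occ a z) (AabTail-occ-b≤ tail)) ⟩
  2 * e + (occ a z + suc (occ a z)) ≡⟨ rearrange e (occ a z) ⟩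
  2 * (e + occ a z) + 1             ≤⟨ +-monoˡ-≤ 1 (*-monoʳ-≤ 2 e+z≤2t) ⟩
  2 * (2 * t) + 1                   ≡⟨ solve [ t ] ⟩
  4 * t + 1                         ∎
  where
  open ≤-Reasoning
  e+z≤2t : e + occ a z ≤ 2 * t
  e+z≤2t = subst₂ _≤_ (cong (_+ occ a z) (occ-replicate a e)) (occ-a-aab^ t) (bound a)
  rearrange : ∀ e x → 2 * e + (x + suc x) ≡ 2 * (e + x) + 1
  rearrange = solve-∀

a^++⊆aab^-occ-b : ∀ t k {w} → a ^ k ++ w ⊆ aab^ t → k + 2 * occ b w ≤ 2 * t + 2
a^++⊆aab^-occ-b t k {w} p with z , tail , w⊆z , bound ← aab^-split t (a ^ k) p = begin
  k + 2 * occ b w   ≤⟨ +-monoʳ-≤ k (*-monoʳ-≤ 2 (occ-mono b w⊆z)) ⟩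
  k + 2 * occ b z   ≤⟨ +-monoʳ-≤ k (AabTail-2*occ-b≤ tail) ⟩
  k + (occ a z + 2) ≡⟨ +-assoc k (occ a z) 2 ⟨
  k + occ a z + 2   ≤⟨ +-monoˡ-≤ 2 k+z≤2t ⟩
  2 * t + 2         ∎
  where
  open ≤-Reasoning
  k+z≤2t : k + occ a z ≤ 2 * t
  k+z≤2t = subst₂ _≤_ (cong (_+ occ a z) (occ-replicate a k)) (occ-a-aab^ t) (bound a)

-- Palindromic and antipalindromic subsequences of (aab)^t a^x b^y

aab^_a^_b^_ : ℕ → ℕ → ℕ → Word
aab^ t a^ x b^ y = aab^ t ++ a ^ x ++ b ^ y

length-aab^a^b^ : ∀ t x y → length (aab^ t a^ x b^ y) ≡ 3 * t + (x + y)
length-aab^a^b^ t x y = begin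
  length (aab^ t ++ a ^ x ++ b ^ y)         ≡⟨ length-++ (aab^ t) ⟩
  length (aab^ t) + length (a ^ x ++ b ^ y) ≡⟨ cong₂ _+_ (length-aab^ t) (length-++ (a ^ x)) ⟩
  3 * t + (length (a ^ x) + length (b ^ y)) ≡⟨ cong₂ (λ p q → 3 * t + (p + q)) (length-replicate x) (length-replicate y) ⟩
  3 * t + (x + y)                           ∎
  where open ≡-Reasoning

record Decomposition (t x y : ℕ) (v : Word) : Set where
  constructor decomposition
  field
    prefix : Word
    j k : ℕ
    v≡prefix++a^j++b^k : v ≡ prefix ++ a ^ j ++ b ^ k
    prefix⊆aab^t : prefix ⊆ aab^ t
    j≤x : j ≤ x
    k≤y : k ≤ y

decompose : ∀ t x y → v ⊆ aab^ t a^ x b^ y → Decomposition t x y v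
decompose t x y p
  with u , v′ , refl , u⊆ , v′⊆ ← ⊆-++⁻ (aab^ t) p
  with va , vb , refl , va⊆ , vb⊆ ← ⊆-++⁻ (a ^ x) v′⊆
  with va≡ , va≤ ← ⊆-replicate⁻ va⊆
  with vb≡ , vb≤ ← ⊆-replicate⁻ vb⊆ =
  decomposition u (length va) (length vb) (cong (u ++_) (cong₂ _++_ va≡ vb≡)) u⊆ va≤ vb≤

length-u++a^j++b^k : ∀ u j k → length (u ++ a ^ j ++ b ^ k) ≡ length u + (j + k)
length-u++a^j++b^k u j k = begin
  length (u ++ a ^ j ++ b ^ k)                 ≡⟨ length-++ u ⟩
  length u + length (a ^ j ++ b ^ k)           ≡⟨ cong (length u +_) (length-++ (a ^ j)) ⟩
  length u + (length (a ^ j) + length (b ^ k)) ≡⟨ cong₂ (λ p q → length u + (p + q))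
                                                        (length-replicate j) (length-replicate k) ⟩
  length u + (j + k)                           ∎
  where open ≡-Reasoning

occ-b-u++a^j++b^k : ∀ u j k → occ b (u ++ a ^ j ++ b ^ k) ≡ occ b u + k
occ-b-u++a^j++b^k u j k = begin
  occ b (u ++ a ^ j ++ b ^ k)                ≡⟨ occ-++ b u _ ⟩
  occ b u + occ b (a ^ j ++ b ^ k)           ≡⟨ cong (occ b u +_) (occ-++ b (a ^ j) (b ^ k)) ⟩
  occ b u + (occ b (a ^ j) + occ b (b ^ k))  ≡⟨ cong₂ (λ p q → occ b u + (p + q))
                                                      (occ-other-replicate a j) (occ-replicate b k) ⟩
  occ b u + k                                ∎
  where open ≡-Reasoning

reverse-u++a^j++b^k : ∀ u j k → reverse (u ++ a ^ j ++ b ^ k) ≡ b ^ k ++ a ^ j ++ reverse u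
reverse-u++a^j++b^k u j k = begin
  reverse (u ++ a ^ j ++ b ^ k)                     ≡⟨ reverse-++ u _ ⟩
  reverse (a ^ j ++ b ^ k) ++ reverse u             ≡⟨ cong (_++ reverse u) (reverse-++ (a ^ j) (b ^ k)) ⟩
  (reverse (b ^ k) ++ reverse (a ^ j)) ++ reverse u ≡⟨ ++-assoc (reverse (b ^ k)) _ _ ⟩
  reverse (b ^ k) ++ reverse (a ^ j) ++ reverse u   ≡⟨ cong₂ (λ p q → p ++ q ++ reverse u)
                                                             (reverse-replicate b k) (reverse-replicate a j) ⟩
  b ^ k ++ a ^ j ++ reverse u                       ∎
  where open ≡-Reasoning

map-other-b^++a^++ : ∀ k j r → map other (b ^ k ++ a ^ j ++ r) ≡ a ^ k ++ b ^ j ++ map other r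
map-other-b^++a^++ k j r = begin
  map other (b ^ k ++ a ^ j ++ r)                       ≡⟨ map-++ other (b ^ k) _ ⟩
  map other (b ^ k) ++ map other (a ^ j ++ r)           ≡⟨ cong (map other (b ^ k) ++_) (map-++ other (a ^ j) r) ⟩
  map other (b ^ k) ++ map other (a ^ j) ++ map other r ≡⟨ cong₂ (λ p q → p ++ q ++ map other r)
                                                                 (map-replicate other k b) (map-replicate other j a) ⟩
  a ^ k ++ b ^ j ++ map other r                         ∎
  where open ≡-Reasoning

palindrome-++a^-bound : ∀ {t x j w} → 2 * t + 1 ≤ x → j ≤ x → w ⊆ aab^ t →
                        w ++ a ^ j ≡ a ^ j ++ reverse w → length w + j ≤ 2 * t + x
palindrome-++a^-bound {t} {x} {j} {w} 2t+1≤x j≤x w⊆ mirror with All≡-or-Any≢ a w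
... | inj₁ all-a = +-mono-≤ |w|≤2t j≤x
  where
  |w|≤2t : length w ≤ 2 * t
  |w|≤2t = begin
    length w       ≡⟨ All≡⇒occ≡length all-a ⟨
    occ a w        ≤⟨ occ-mono a w⊆ ⟩
    occ a (aab^ t) ≡⟨ occ-a-aab^ t ⟩
    2 * t          ∎
    where open ≤-Reasoning
... | inj₂ any with w′ , refl ← replicate-prefix j any mirror = begin
  length (a ^ j ++ w′) + j       ≡⟨ cong (_+ j) (length-++ (a ^ j)) ⟩
  length (a ^ j) + length w′ + j ≡⟨ cong (λ p → p + length w′ + j) (length-replicate j) ⟩
  j + length w′ + j              ≡⟨ rearrange j (length w′) ⟩
  2 * j + length w′              ≤⟨ a^++⊆aab^-length t j w⊆ ⟩
  4 * t + 1                      ≡⟨ solve [ t ] ⟩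
  2 * t + (2 * t + 1)            ≤⟨ +-monoʳ-≤ (2 * t) 2t+1≤x ⟩
  2 * t + x                      ∎
  where
  open ≤-Reasoning
  rearrange : ∀ j l → j + l + j ≡ 2 * j + l
  rearrange = solve-∀

palindrome-b^l++a^j++b^k⇒j≡0⊎l≡k : ∀ l j k → b ^ l ++ a ^ j ++ b ^ k ≡ b ^ k ++ a ^ j ++ b ^ l →
                                    j ≡ 0 ⊎ l ≡ k
palindrome-b^l++a^j++b^k⇒j≡0⊎l≡k l zero k _ = inj₁ refl
palindrome-b^l++a^j++b^k⇒j≡0⊎l≡k l (suc j) k mirror = inj₂ (replicate-++-injective l k (λ ()) mirror)

palindrome-peel-b^ : ∀ k j w → (b ^ k ++ w) ++ a ^ j ++ b ^ k ≡ b ^ k ++ a ^ j ++ reverse (b ^ k ++ w) →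
                     w ++ a ^ j ≡ a ^ j ++ reverse w
palindrome-peel-b^ k j w mirror = ++-cancel-ends (b ^ k) (begin
  b ^ k ++ (w ++ a ^ j) ++ b ^ k                 ≡⟨ cong (b ^ k ++_) (++-assoc w (a ^ j) (b ^ k)) ⟩
  b ^ k ++ w ++ a ^ j ++ b ^ k                   ≡⟨ ++-assoc (b ^ k) w _ ⟨
  (b ^ k ++ w) ++ a ^ j ++ b ^ k                 ≡⟨ mirror ⟩
  b ^ k ++ a ^ j ++ reverse (b ^ k ++ w)         ≡⟨ cong (λ r → b ^ k ++ a ^ j ++ r) (reverse-++ (b ^ k) w) ⟩
  b ^ k ++ a ^ j ++ reverse w ++ reverse (b ^ k) ≡⟨ cong (λ r → b ^ k ++ a ^ j ++ reverse w ++ r) (reverse-replicate b k) ⟩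
  b ^ k ++ a ^ j ++ reverse w ++ b ^ k           ≡⟨ cong (b ^ k ++_) (++-assoc (a ^ j) (reverse w) (b ^ k)) ⟨
  b ^ k ++ (a ^ j ++ reverse w) ++ b ^ k         ∎)
  where open ≡-Reasoning

palindrome-b^a^b^-bound : ∀ {t x y l j k} → y ≤ t + x → l ≤ t → j ≤ x → k ≤ y →
                          b ^ l ++ a ^ j ++ b ^ k ≡ b ^ k ++ a ^ j ++ b ^ l → l + (j + k) ≤ 2 * t + x
palindrome-b^a^b^-bound {t} {x} {y} {l} {j} {k} y≤t+x l≤t j≤x k≤y mirror
  with palindrome-b^l++a^j++b^k⇒j≡0⊎l≡k l j k mirror
... | inj₁ refl = begin
  l + k       ≤⟨ +-mono-≤ l≤t (≤-trans k≤y y≤t+x) ⟩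
  t + (t + x) ≡⟨ +-assoc t t x ⟨
  t + t + x   ≡⟨ cong (_+ x) (solve [ t ]) ⟩
  2 * t + x   ∎
  where open ≤-Reasoning
... | inj₂ refl = begin
  l + (j + l) ≤⟨ +-mono-≤ l≤t (+-mono-≤ j≤x l≤t) ⟩
  t + (x + t) ≡⟨ rearrange t x ⟩
  2 * t + x   ∎
  where
  open ≤-Reasoning
  rearrange : ∀ t x → t + (x + t) ≡ 2 * t + x
  rearrange = solve-∀

palindrome-bound : ∀ t x y {v} → 2 * t + 1 ≤ x → y ≤ t + x →
                   v ⊆ aab^ t a^ x b^ y → v ≡ reverse v → length v ≤ 2 * t + x
palindrome-bound t x y 2t+1≤x y≤t+x v⊆ pal
  with decomposition u j k refl u⊆ j≤x k≤y ← decompose t x y v⊆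
  with mirror ← trans pal (reverse-u++a^j++b^k u j k)
  rewrite length-u++a^j++b^k u j k
  with All≡-or-Any≢ b u
... | inj₁ all-b = palindrome-b^a^b^-bound y≤t+x |u|≤t j≤x k≤y mirror′
  where
  |u|≤t : length u ≤ t
  |u|≤t = begin
    length u       ≡⟨ All≡⇒occ≡length all-b ⟨
    occ b u        ≤⟨ occ-mono b u⊆ ⟩
    occ b (aab^ t) ≡⟨ occ-b-aab^ t ⟩
    t              ∎
    where open ≤-Reasoning
  mirror′ : b ^ length u ++ a ^ j ++ b ^ k ≡ b ^ k ++ a ^ j ++ b ^ length u
  mirror′ = trans (subst (λ r → r ++ a ^ j ++ b ^ k ≡ b ^ k ++ a ^ j ++ reverse r) (All≡⇒replicate all-b) mirror)
                  (cong (λ r → b ^ k ++ a ^ j ++ r) (reverse-replicate b (length u)))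
-- A palindrome ending in b^k begins with b^k.
... | inj₂ any
  with w , refl ← replicate-prefix k any mirror
  with t′ , k+t′≤t , w⊆ ← b^++⊆aab^ t k u⊆ = begin
  length (b ^ k ++ w) + (j + k)       ≡⟨ cong (λ p → p + (j + k)) (length-++ (b ^ k)) ⟩
  length (b ^ k) + length w + (j + k) ≡⟨ cong (λ p → p + length w + (j + k)) (length-replicate k) ⟩
  k + length w + (j + k)              ≡⟨ rearrange k (length w) j ⟩
  2 * k + (length w + j)              ≤⟨ +-monoʳ-≤ (2 * k) (palindrome-++a^-bound 2t′+1≤x j≤x w⊆ inner) ⟩
  2 * k + (2 * t′ + x)                ≡⟨ rearrange′ k t′ x ⟩
  2 * (k + t′) + x                    ≤⟨ +-monoˡ-≤ x (*-monoʳ-≤ 2 k+t′≤t) ⟩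
  2 * t + x                           ∎
  where
  open ≤-Reasoning
  inner : w ++ a ^ j ≡ a ^ j ++ reverse w
  inner = palindrome-peel-b^ k j w mirror
  2t′+1≤x : 2 * t′ + 1 ≤ x
  2t′+1≤x = ≤-trans (+-monoˡ-≤ 1 (*-monoʳ-≤ 2 (m+n≤o⇒n≤o k k+t′≤t))) 2t+1≤x
  rearrange : ∀ k l j → k + l + (j + k) ≡ 2 * k + (l + j)
  rearrange = solve-∀
  rearrange′ : ∀ k t′ x → 2 * k + (2 * t′ + x) ≡ 2 * (k + t′) + x
  rearrange′ = solve-∀

-- An antipalindrome ending in b^k begins with a^k.
antipalindrome-prefix-bound : ∀ {t y j k u} → k ≤ y → u ⊆ aab^ t → Any (_≢ a) u →
                              u ++ a ^ j ++ b ^ k ≡ a ^ k ++ b ^ j ++ map other (reverse u) →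
                              (occ b u + k) + (occ b u + k) ≤ 2 * t + 2 + y
antipalindrome-prefix-bound {t} {y} {j} {k} k≤y u⊆ any mirror
  with w , refl ← replicate-prefix k any mirror = begin
  (occ b (a ^ k ++ w) + k) + (occ b (a ^ k ++ w) + k) ≡⟨ cong (λ p → (p + k) + (p + k)) occ-b-u≡occ-b-w ⟩
  (occ b w + k) + (occ b w + k)                       ≡⟨ rearrange (occ b w) k ⟩
  (k + 2 * occ b w) + k                               ≤⟨ +-mono-≤ (a^++⊆aab^-occ-b t k u⊆) k≤y ⟩
  2 * t + 2 + y                                       ∎
  where
  open ≤-Reasoning
  occ-b-u≡occ-b-w : occ b (a ^ k ++ w) ≡ occ b w
  occ-b-u≡occ-b-w = trans (occ-++ b (a ^ k) w) (cong (_+ occ b w) (occ-other-replicate a k))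
  rearrange : ∀ m k → (m + k) + (m + k) ≡ (k + 2 * m) + k
  rearrange = solve-∀

antipalindrome-bound : ∀ t x y {v} → v ⊆ aab^ t a^ x b^ y → v ≡ map other (reverse v) →
                       ∃ λ m → length v ≡ m + m × (m ≤ y ⊎ m + m ≤ 2 * t + 2 + y)
antipalindrome-bound t x y v⊆ anti
  with decomposition u j k refl u⊆ j≤x k≤y ← decompose t x y v⊆ =
  occ b u + k , length≡ , bound (All≡-or-Any≢ a u)
  where
  length≡ : length (u ++ a ^ j ++ b ^ k) ≡ (occ b u + k) + (occ b u + k)
  length≡ = begin
    length (u ++ a ^ j ++ b ^ k)                              ≡⟨ occ+occ-other a (u ++ a ^ j ++ b ^ k) ⟨
    occ a (u ++ a ^ j ++ b ^ k) + occ b (u ++ a ^ j ++ b ^ k) ≡⟨ cong (_+ occ b (u ++ a ^ j ++ b ^ k))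
                                                                     (antipalindrome⇒occ-a≡occ-b anti) ⟩
    occ b (u ++ a ^ j ++ b ^ k) + occ b (u ++ a ^ j ++ b ^ k) ≡⟨ cong (λ p → p + p) (occ-b-u++a^j++b^k u j k) ⟩
    (occ b u + k) + (occ b u + k)                             ∎
    where open ≡-Reasoning
  mirror : u ++ a ^ j ++ b ^ k ≡ a ^ k ++ b ^ j ++ map other (reverse u)
  mirror = begin
    u ++ a ^ j ++ b ^ k                       ≡⟨ anti ⟩
    map other (reverse (u ++ a ^ j ++ b ^ k)) ≡⟨ cong (map other) (reverse-u++a^j++b^k u j k) ⟩
    map other (b ^ k ++ a ^ j ++ reverse u)   ≡⟨ map-other-b^++a^++ k j (reverse u) ⟩
    a ^ k ++ b ^ j ++ map other (reverse u)   ∎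
    where open ≡-Reasoning
  bound : All (_≡ a) u ⊎ Any (_≢ a) u → occ b u + k ≤ y ⊎ (occ b u + k) + (occ b u + k) ≤ 2 * t + 2 + y
  bound (inj₁ all-a) rewrite All≡⇒occ-other≡0 all-a = inj₁ k≤y
  bound (inj₂ any) = inj₂ (antipalindrome-prefix-bound k≤y u⊆ any mirror)

-- The lower bound

palOrAntipal-bound : ∀ t {p q B v} → 1 ≤ p → q ≤ p → p ≤ B → 2 * q ≤ B → 2 + 2 * (q / 2) ≤ B →
                     v ⊆ aab^ t a^ (2 * t + p) b^ (2 * t + q) → PalOrAntipal v → length v ≤ 4 * t + B
palOrAntipal-bound t {p} {q} {B} {v} 1≤p q≤p p≤B _ _ v⊆ (inj₁ pal) = begin
  length v            ≤⟨ palindrome-bound t (2 * t + p) (2 * t + q) 2t+1≤x y≤t+x v⊆ (Palindrome⇒≡reverse pal) ⟩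
  2 * t + (2 * t + p) ≤⟨ +-monoʳ-≤ (2 * t) (+-monoʳ-≤ (2 * t) p≤B) ⟩
  2 * t + (2 * t + B) ≡⟨ rearrange t B ⟩
  4 * t + B           ∎
  where
  open ≤-Reasoning
  2t+1≤x : 2 * t + 1 ≤ 2 * t + p
  2t+1≤x = +-monoʳ-≤ (2 * t) 1≤p
  y≤t+x : 2 * t + q ≤ t + (2 * t + p)
  y≤t+x = ≤-trans (+-monoʳ-≤ (2 * t) q≤p) (m≤n+m (2 * t + p) t)
  rearrange : ∀ t B → 2 * t + (2 * t + B) ≡ 4 * t + B
  rearrange = solve-∀
palOrAntipal-bound t {p} {q} {B} {v} _ _ _ 2q≤B parity v⊆ (inj₂ anti)
  with antipalindrome-bound t (2 * t + p) (2 * t + q) v⊆ (Antipalindrome⇒≡map-other-reverse anti)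
... | m , length≡ , inj₁ m≤y = begin
  length v                  ≡⟨ length≡ ⟩
  m + m                     ≤⟨ +-mono-≤ m≤y m≤y ⟩
  (2 * t + q) + (2 * t + q) ≡⟨ rearrange t q ⟩
  4 * t + 2 * q             ≤⟨ +-monoʳ-≤ (4 * t) 2q≤B ⟩
  4 * t + B                 ∎
  where
  open ≤-Reasoning
  rearrange : ∀ t q → (2 * t + q) + (2 * t + q) ≡ 4 * t + 2 * q
  rearrange = solve-∀
... | m , length≡ , inj₂ m+m≤ = begin
  length v                              ≡⟨ length≡ ⟩
  m + m                                 ≤⟨ m+m≤n⇒m+m≤2*[n/2] {m} m+m≤ ⟩
  2 * ((2 * t + 2 + (2 * t + q)) / 2)   ≡⟨ cong (λ n → 2 * (n / 2)) (rearrange t q) ⟩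
  2 * ((2 * (2 * t + 1) + q) / 2)       ≡⟨ cong (2 *_) ([2m+n]/2≡m+n/2 (2 * t + 1) q) ⟩
  2 * (2 * t + 1 + q / 2)               ≡⟨ rearrange′ t (q / 2) ⟩
  4 * t + (2 + 2 * (q / 2))             ≤⟨ +-monoʳ-≤ (4 * t) parity ⟩
  4 * t + B                             ∎
  where
  open ≤-Reasoning
  rearrange : ∀ t q → 2 * t + 2 + (2 * t + q) ≡ 2 * (2 * t + 1) + q
  rearrange = solve-∀
  rearrange′ : ∀ t s → 2 * (2 * t + 1 + s) ≡ 4 * t + (2 + 2 * s)
  rearrange′ = solve-∀

deletions-bound : ∀ r t B k → 3 * B < 2 * r + 9 → 3 + (r + t * 7) ≤ 4 * t + B + k →
                  (3 + (r + t * 7) + 2 * t) / 3 ≤ k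
deletions-bound r t B k 3B<2r+9 n≤ = s≤s⁻¹ (m<n*o⇒m/o<n (begin-strict
  3 + (r + t * 7) + 2 * t ≡⟨ rearrange r t ⟩
  3 + (r + 9 * t)         <⟨ +-monoʳ-< 3 r+9t<3k ⟩
  3 + 3 * k               ≡⟨ solve [ k ] ⟩
  suc k * 3               ∎))
  where
  open ≤-Reasoning
  rearrange : ∀ r t → 3 + (r + t * 7) + 2 * t ≡ 3 + (r + 9 * t)
  rearrange = solve-∀
  r+9t<3k : r + 9 * t < 3 * k
  r+9t<3k = +-cancelˡ-< (9 + 2 * r + 12 * t) (r + 9 * t) (3 * k) (begin-strict
    (9 + 2 * r + 12 * t) + (r + 9 * t) ≡⟨ e₁ r t ⟩
    3 * (3 + (r + t * 7))              ≤⟨ *-monoʳ-≤ 3 n≤ ⟩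
    3 * (4 * t + B + k)                ≡⟨ e₂ t B k ⟩
    3 * B + (12 * t + 3 * k)           <⟨ +-monoˡ-< (12 * t + 3 * k) 3B<2r+9 ⟩
    2 * r + 9 + (12 * t + 3 * k)       ≡⟨ e₃ r t k ⟩
    (9 + 2 * r + 12 * t) + 3 * k       ∎)
    where
    e₁ : ∀ r t → (9 + 2 * r + 12 * t) + (r + 9 * t) ≡ 3 * (3 + (r + t * 7))
    e₁ = solve-∀
    e₂ : ∀ t B k → 3 * (4 * t + B + k) ≡ 3 * B + (12 * t + 3 * k)
    e₂ = solve-∀
    e₃ : ∀ r t k → 2 * r + 9 + (12 * t + 3 * k) ≡ (9 + 2 * r + 12 * t) + 3 * k
    e₃ = solve-∀

-- Conditions on the word aab^ t a^ (2 * t + p) b^ (2 * t + q), of length 3 + r + 7t: the middle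
-- five bound its palindromic and antipalindromic subsequences by 4t + B (2 + 2 * (q / 2) is 2 + q
-- rounded down to an even number, as antipalindromes have even length), and the last one makes the
-- 3 + r + 3t − B deletions at least ⌊(3 + r + 9t) / 3⌋.
Admissible : ℕ → ℕ → ℕ → ℕ → Set
Admissible r p q B =
  p + q ≡ 3 + r × 1 ≤ p × q ≤ p × p ≤ B × 2 * q ≤ B × 2 + 2 * (q / 2) ≤ B × 3 * B < 2 * r + 9

admissible? : ∀ r p q B → Dec (Admissible r p q B)
admissible? r p q B =
  p + q ≟ℕ 3 + r ×-dec 1 ≤? p ×-dec q ≤? p ×-dec p ≤? B ×-dec 2 * q ≤? B ×-dec 2 + 2 * (q / 2) ≤? B
  ×-dec 3 * B <? 2 * r + 9

Offsets : ℕ → Set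
Offsets r = Σ ℕ λ p → Σ ℕ λ q → Σ ℕ λ B → Admissible r p q B

offsets : ∀ r p q B → {True (admissible? r p q B)} → Offsets r
offsets r p q B {ok} = p , q , B , toWitness ok

offsets-for : ∀ r → r < 7 → Offsets r
offsets-for 0 _ = offsets 0 2 1 2
offsets-for 1 _ = offsets 1 3 1 3
offsets-for 2 _ = offsets 2 3 2 4
offsets-for 3 _ = offsets 3 4 2 4
offsets-for 4 _ = offsets 4 5 2 5
offsets-for 5 _ = offsets 5 5 3 6
offsets-for 6 _ = offsets 6 6 3 6
offsets-for (suc (suc (suc (suc (suc (suc (suc _))))))) (s≤s (s≤s (s≤s (s≤s (s≤s (s≤s (s≤s ())))))))

lower-bound-residue : ∀ r t → r < 7 → ∃ λ w → length w ≡ 3 + (r + t * 7) ×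
                      (∀ k → DeletableTo w k → (3 + (r + t * 7) + 2 * t) / 3 ≤ k)
lower-bound-residue r t r<7
  with p , q , B , p+q≡3+r , 1≤p , q≤p , p≤B , 2q≤B , parity , 3B<2r+9 ← offsets-for r r<7 =
  word , length≡ , deletions
  where
  word = aab^ t a^ (2 * t + p) b^ (2 * t + q)
  length≡ : length word ≡ 3 + (r + t * 7)
  length≡ = begin
    length word                         ≡⟨ length-aab^a^b^ t (2 * t + p) (2 * t + q) ⟩
    3 * t + ((2 * t + p) + (2 * t + q)) ≡⟨ rearrange t p q ⟩
    (p + q) + t * 7                     ≡⟨ cong (_+ t * 7) p+q≡3+r ⟩
    3 + r + t * 7                       ≡⟨ +-assoc 3 r (t * 7) ⟩
    3 + (r + t * 7)                     ∎
    where
    open ≡-Reasoning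
    rearrange : ∀ t p q → 3 * t + ((2 * t + p) + (2 * t + q)) ≡ (p + q) + t * 7
    rearrange = solve-∀
  deletions : ∀ k → DeletableTo word k → (3 + (r + t * 7) + 2 * t) / 3 ≤ k
  deletions k (v , v⊆word , v+k≡word , v-sym) = deletions-bound r t B k 3B<2r+9 (begin
    3 + (r + t * 7) ≡⟨ length≡ ⟨
    length word     ≡⟨ v+k≡word ⟨
    length v + k    ≤⟨ +-monoˡ-≤ k (palOrAntipal-bound t 1≤p q≤p p≤B 2q≤B parity v⊆word v-sym) ⟩
    4 * t + B + k   ∎)
    where open ≤-Reasoning

lower-bound-word : ∀ n → 2 ≤ n → ∃ λ w → length w ≡ n ×
                   (∀ k → DeletableTo w k → (n + 2 * ((n ∸ 3) / 7)) / 3 ≤ k)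
lower-bound-word 1 (s≤s ())
lower-bound-word 2 _ = a ^ 2 , refl , λ _ _ → z≤n
lower-bound-word (suc (suc (suc n′))) _ =
  subst (λ m → ∃ λ w → length w ≡ 3 + m × (∀ k → DeletableTo w k → (3 + m + 2 * (n′ / 7)) / 3 ≤ k))
        (sym (m≡m%n+[m/n]*n n′ 7))
        (lower-bound-residue (n′ % 7) (n′ / 7) (m%n<n n′ 7))

theorem1 : (n : ℕ) → 2 ≤ n →
    Σ ℕ (λ m → IsSd n m
    × ((n + 2 * ((n ∸ 3) / 7)) / 3 ≤ m)
    × (m ≤ n / 2))
theorem1 n 2≤n = m , isSd , lower , upper
  where
  m : ℕ
  m = proj₁ (IsSd-exists n)
  isSd : IsSd n m
  isSd = proj₂ (IsSd-exists n)
  upper : m ≤ n / 2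
  upper = let w , w-length , sd-w = proj₁ isSd in
    subst (λ l → m ≤ l / 2) w-length (IsSdWord⇒≤half sd-w)
  lower : (n + 2 * ((n ∸ 3) / 7)) / 3 ≤ m
  lower = let w₀ , w₀-length , w₀-deletions = lower-bound-word n 2≤n in
    ≤-trans (w₀-deletions _ (proj₁ (IsSdWord-sdWord w₀))) (proj₂ isSd w₀ w₀-length _ (IsSdWord-sdWord w₀))
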